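{- Let $p$ be a prime and $n\geq p$ an integer. Then $B_{n-p}\equiv V_n \pmod p$.
   Context: $B_n$ is the $n$-th Bell number (number of partitions of an $n$-element set). $V_n$ is the number of partitions of $\{1,2,\dots,n\}$ into non-empty blocks none of which is a singleton (equivalently, $\sum_{n\ge0}V_n t^n/n!=e^{e^t-1-t}$). -}

module Defs where

open import Data.Nat using (ℕ; zero; suc; _+_; _*_; _∸_)
open import Data.Nat.Combinatorics using (_C_)
open import Data.List using (List; map; upTo)
open import Data.Nat.ListAction using (sum)

-- Bell numbers B n : number of partitions of an n-element set, via the standard
-- recurrence obtained by choosing the block containing the last element:
--   B 0 = 1,  B (n+1) = Σ_{k=0}^{n} C(n,k) B(n-k)
-- (k = number of other elements in the block of the last element).
-- Both sequences are computed as lists of all earlier values (structural recursion).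

private
  lookupRev : List ℕ → ℕ → ℕ
  lookupRev Data.List.[] _ = 0
  lookupRev (x Data.List.∷ xs) zero = x
  lookupRev (x Data.List.∷ xs) (suc k) = lookupRev xs k

-- Given prev = [a n, a (n-1), …, a 0], lookupRev prev k = a (n - k).
bellList : ℕ → List ℕ
bellList zero = 1 Data.List.∷ Data.List.[]
bellList (suc n) =
  sum (map (λ k → (n C k) * lookupRev (bellList n) k) (upTo (suc n)))
    Data.List.∷ bellList n

B : ℕ → ℕ
B n = lookupRev (bellList n) 0

-- V n : partitions of {1..n} with no singleton block. Block of the last element
-- must contain k ≥ 1 other elements:
--   V 0 = 1,  V (n+1) = Σ_{k=1}^{n} C(n,k) V(n-k).
vList : ℕ → List ℕ
vList zero = 1 Data.List.∷ Data.List.[]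
vList (suc n) =
  sum (map (λ k → (n C suc k) * lookupRev (vList n) (suc k)) (upTo n))
    Data.List.∷ vList n

V : ℕ → ℕ
V n = lookupRev (vList n) 0

{-# OPTIONS --safe #-}

-- Write T c a n = ∑ᵢ C(n,i) c^(n-i) aᵢ, so that T c ∘ T d = T (c + d). The recurrences defining
-- B and V say B (n+1) = T 1 B n and T 1 V = B, whence V = T (-1) B. Expanding in Stirling numbers
-- of the second kind, B (m+n) = ∑ⱼ S(m,j) · T j B n. For a prime p, Fermat gives
-- j! S(p,j) = T (-1) (i ↦ iᵖ) j ≡ T (-1) (i ↦ i) j = j! S(1,j), so S(p,j) ≡ 0 for 1 < j < p;
-- together with T p B ≡ B this is Touchard's congruence B (p+n) ≡ B (n+1) + B n. Finally
-- V p = T (-1) B p ≡ (-1)ᵖ + B p ≡ 1 = B 0, and V (n+1) = B n - V n carries V (p+m) ≡ B m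
-- from m to m + 1.

module Submission where

open import Defs
open import Data.Nat using (ℕ; _≥_; _∸_)
open import Data.Nat.Primality using (Prime)
open import Data.Integer using (+_; _-_)
open import Data.Integer.Divisibility using (_∣_)

open import Data.Nat as ℕ using (zero; suc; _<_; _≤_; z≤n; s≤s; _!)
import Data.Nat.Properties as ℕₚ
open import Data.Nat.Combinatorics using (_C_; nC1≡n; nCk+nC[k+1]≡[n+1]C[k+1]; nCk≡nC[n∸k]; k>n⇒nCk≡0; nCn≡1)
open import Data.Integer using (ℤ; 0ℤ; 1ℤ; -1ℤ; _+_; _*_; -_; _^_)
import Data.Integer.Properties as ℤₚ
open import Data.Integer.Tactic.RingSolver using (solve-∀)
import Data.Nat.Tactic.RingSolver as ℕ-Solver
open import Data.List using (map; upTo; [_]; _++_; _∷ʳ_)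
open import Data.List.Properties using (upTo-∷ʳ; map-++)
open import Data.Nat.ListAction using (sum)
open import Data.Nat.ListAction.Properties using (sum-++)
open import Function using (_∘_)
open import Relation.Nullary using (yes; no; ¬_)
open import Relation.Binary.Bundles using (Setoid)
import Relation.Binary.Reasoning.Setoid as SetoidReasoning
open import Data.Nat.Divisibility as ℕ using (divides; >⇒∤)
open import Data.Nat.Primality using (euclidsLemma; ¬prime[0]; ¬prime[1])
import Data.Integer.Divisibility.Signed as Signed
open import Data.Sum using (inj₁; inj₂)
open import Data.Empty using (⊥-elim)
open import Relation.Binary.PropositionalEquality
  using (_≡_; refl; sym; trans; cong; cong₂; subst; module ≡-Reasoning)

-- Finite sums

∑ : ℕ → (ℕ → ℤ) → ℤ
∑ zero    f = 0ℤ
∑ (suc n) f = ∑ n f + f n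

syntax ∑ n (λ i → f) = ∑[ i < n ] f

∑-cong : ∀ n {f g : ℕ → ℤ} → (∀ i → i < n → f i ≡ g i) → ∑ n f ≡ ∑ n g
∑-cong zero    f≡g = refl
∑-cong (suc n) f≡g =
  cong₂ _+_ (∑-cong n (λ i i<n → f≡g i (ℕₚ.m<n⇒m<1+n i<n))) (f≡g n (ℕₚ.n<1+n n))

∑-head : ∀ n (f : ℕ → ℤ) → ∑ (suc n) f ≡ f 0 + ∑ n (f ∘ suc)
∑-head zero    f = trans (ℤₚ.+-identityˡ (f 0)) (sym (ℤₚ.+-identityʳ (f 0)))
∑-head (suc n) f = trans (cong (_+ f (suc n)) (∑-head n f)) (ℤₚ.+-assoc (f 0) _ _)

∑-last-zero : ∀ n (f : ℕ → ℤ) → f n ≡ 0ℤ → ∑ (suc n) f ≡ ∑ n f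
∑-last-zero n f fn≡0 = trans (cong (_+_ (∑ n f)) fn≡0) (ℤₚ.+-identityʳ (∑ n f))

∑-drop-head : ∀ n (f : ℕ → ℤ) → f 0 ≡ 0ℤ → ∑ (suc n) f ≡ ∑ n (f ∘ suc)
∑-drop-head n f f0≡0 =
  trans (∑-head n f) (trans (cong (_+ ∑ n (f ∘ suc)) f0≡0) (ℤₚ.+-identityˡ (∑ n (f ∘ suc))))

∑-shift : ∀ n (f : ℕ → ℤ) → f 0 ≡ 0ℤ → f (suc n) ≡ 0ℤ → ∑ (suc n) f ≡ ∑ (suc n) (f ∘ suc)
∑-shift n f f0≡0 fn≡0 = trans (∑-drop-head n f f0≡0) (sym (∑-last-zero n (f ∘ suc) fn≡0))

∑-reverse : ∀ n (f : ℕ → ℤ) → ∑ (suc n) f ≡ ∑[ k < suc n ] (f (n ∸ k))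
∑-reverse zero    f = refl
∑-reverse (suc n) f = begin
  ∑ (suc n) f + f (suc n)                  ≡⟨ cong (_+ f (suc n)) (∑-reverse n f) ⟩
  ∑[ k < suc n ] (f (n ∸ k)) + f (suc n)   ≡⟨ ℤₚ.+-comm _ (f (suc n)) ⟩
  f (suc n) + ∑[ k < suc n ] (f (n ∸ k))   ≡⟨ ∑-head (suc n) (λ k → f (suc n ∸ k)) ⟨
  ∑[ k < suc (suc n) ] (f (suc n ∸ k))     ∎
  where open ≡-Reasoning

∑-+ : ∀ n (f g : ℕ → ℤ) → ∑[ i < n ] (f i + g i) ≡ ∑ n f + ∑ n g
∑-+ zero    f g = refl
∑-+ (suc n) f g = trans (cong (_+ (f n + g n)) (∑-+ n f g)) (interchange (∑ n f) _ _ _)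
  where
  interchange : ∀ a b c d → (a + b) + (c + d) ≡ (a + c) + (b + d)
  interchange = solve-∀

∑-*ˡ : ∀ n u (f : ℕ → ℤ) → ∑[ i < n ] (u * f i) ≡ u * ∑ n f
∑-*ˡ zero    u f = sym (ℤₚ.*-zeroʳ u)
∑-*ˡ (suc n) u f =
  trans (cong (_+ u * f n) (∑-*ˡ n u f)) (sym (ℤₚ.*-distribˡ-+ u (∑ n f) (f n)))

sum-upTo : ∀ n (f : ℕ → ℕ) → + sum (map f (upTo n)) ≡ ∑[ i < n ] (+ f i)
sum-upTo zero    f = refl
sum-upTo (suc n) f = begin
  + sum (map f (upTo (suc n)))              ≡⟨ cong (λ xs → + sum (map f xs)) (upTo-∷ʳ n) ⟨
  + sum (map f (upTo n ∷ʳ n))               ≡⟨ cong (+_ ∘ sum) (map-++ f (upTo n) [ n ]) ⟩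
  + sum (map f (upTo n) ++ [ f n ])         ≡⟨ cong +_ (sum-++ (map f (upTo n)) [ f n ]) ⟩
  + (sum (map f (upTo n)) ℕ.+ (f n ℕ.+ 0))  ≡⟨ ℤₚ.pos-+ (sum (map f (upTo n))) (f n ℕ.+ 0) ⟩
  + sum (map f (upTo n)) + + (f n ℕ.+ 0)    ≡⟨ cong₂ _+_ (sum-upTo n f) (cong +_ (ℕₚ.+-identityʳ (f n))) ⟩
  ∑[ i < suc n ] (+ f i)                    ∎
  where open ≡-Reasoning

-- Binomial coefficients

-- For i ≥ n the truncated exponents coincide, and the vanishing coefficient saves the identity.
C-pow-shift : ∀ n i c → + (n C suc i) * c ^ (n ∸ i) ≡ c * (+ (n C suc i) * c ^ (n ∸ suc i))
C-pow-shift n i c with i ℕ.<? n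
... | yes i<n = trans (cong (λ e → + (n C suc i) * c ^ e) (ℕₚ.+-∸-assoc 1 i<n)) (swap (+ (n C suc i)) c _)
  where
  swap : ∀ k c x → k * (c * x) ≡ c * (k * x)
  swap = solve-∀
... | no  i≮n rewrite k>n⇒nCk≡0 (s≤s (ℕₚ.≮⇒≥ i≮n)) = both-zero c (c ^ (n ∸ i)) (c ^ (n ∸ suc i))
  where
  both-zero : ∀ c x y → 0ℤ * x ≡ c * (0ℤ * y)
  both-zero = solve-∀

pascal-term : ∀ n i c x →
  + (suc n C suc i) * c ^ (n ∸ i) * x ≡ + (n C i) * c ^ (n ∸ i) * x + c * (+ (n C suc i) * c ^ (n ∸ suc i) * x)
pascal-term n i c x = begin
  + (suc n C suc i) * c ^ (n ∸ i) * x
    ≡⟨ cong (λ k → + k * c ^ (n ∸ i) * x) (nCk+nC[k+1]≡[n+1]C[k+1] n i) ⟨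
  + (n C i ℕ.+ n C suc i) * c ^ (n ∸ i) * x
    ≡⟨ cong (λ k → k * c ^ (n ∸ i) * x) (ℤₚ.pos-+ (n C i) (n C suc i)) ⟩
  (+ (n C i) + + (n C suc i)) * c ^ (n ∸ i) * x
    ≡⟨ distrib (+ (n C i)) (+ (n C suc i)) (c ^ (n ∸ i)) x ⟩
  + (n C i) * c ^ (n ∸ i) * x + + (n C suc i) * c ^ (n ∸ i) * x
    ≡⟨ cong (λ y → + (n C i) * c ^ (n ∸ i) * x + y * x) (C-pow-shift n i c) ⟩
  + (n C i) * c ^ (n ∸ i) * x + c * (+ (n C suc i) * c ^ (n ∸ suc i)) * x
    ≡⟨ cong (_+_ (+ (n C i) * c ^ (n ∸ i) * x)) (ℤₚ.*-assoc c _ x) ⟩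
  + (n C i) * c ^ (n ∸ i) * x + c * (+ (n C suc i) * c ^ (n ∸ suc i) * x) ∎
  where
  open ≡-Reasoning
  distrib : ∀ k k′ e x → (k + k′) * e * x ≡ k * e * x + k′ * e * x
  distrib = solve-∀

[k+1]*[n+1]C[k+1]≡[n+1]*nCk : ∀ n k → suc k ℕ.* (suc n C suc k) ≡ suc n ℕ.* (n C k)
[k+1]*[n+1]C[k+1]≡[n+1]*nCk zero    zero    = refl
[k+1]*[n+1]C[k+1]≡[n+1]*nCk zero    (suc k) = ℕₚ.*-zeroʳ (suc (suc k))
[k+1]*[n+1]C[k+1]≡[n+1]*nCk (suc n) zero    =
  trans (ℕₚ.+-identityʳ _) (trans (nC1≡n (suc (suc n))) (sym (ℕₚ.*-identityʳ (suc (suc n)))))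
[k+1]*[n+1]C[k+1]≡[n+1]*nCk (suc n) (suc k) = begin
  suc (suc k) ℕ.* (suc (suc n) C suc (suc k))
    ≡⟨ cong (suc (suc k) ℕ.*_) (nCk+nC[k+1]≡[n+1]C[k+1] (suc n) (suc k)) ⟨
  suc (suc k) ℕ.* (suc n C suc k ℕ.+ suc n C suc (suc k))
    ≡⟨ regroup (suc n C suc k) (suc n C suc (suc k)) k ⟩
  suc n C suc k ℕ.+ suc k ℕ.* (suc n C suc k) ℕ.+ suc (suc k) ℕ.* (suc n C suc (suc k))
    ≡⟨ cong₂ (λ x y → suc n C suc k ℕ.+ x ℕ.+ y) ([k+1]*[n+1]C[k+1]≡[n+1]*nCk n k) ([k+1]*[n+1]C[k+1]≡[n+1]*nCk n (suc k)) ⟩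
  suc n C suc k ℕ.+ suc n ℕ.* (n C k) ℕ.+ suc n ℕ.* (n C suc k)
    ≡⟨ ℕₚ.+-assoc (suc n C suc k) _ _ ⟩
  suc n C suc k ℕ.+ (suc n ℕ.* (n C k) ℕ.+ suc n ℕ.* (n C suc k))
    ≡⟨ cong (suc n C suc k ℕ.+_) (ℕₚ.*-distribˡ-+ (suc n) (n C k) (n C suc k)) ⟨
  suc n C suc k ℕ.+ suc n ℕ.* (n C k ℕ.+ n C suc k)
    ≡⟨ cong (λ x → suc n C suc k ℕ.+ suc n ℕ.* x) (nCk+nC[k+1]≡[n+1]C[k+1] n k) ⟩
  suc (suc n) ℕ.* (suc n C suc k) ∎
  where
  open ≡-Reasoning
  regroup : ∀ x y k → suc (suc k) ℕ.* (x ℕ.+ y) ≡ x ℕ.+ suc k ℕ.* x ℕ.+ suc (suc k) ℕ.* y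
  regroup = ℕ-Solver.solve-∀

-- The binomial transform

-- The operator (c + shift)ⁿ applied to a and read off at 0; T-explicit gives the closed form.
T : ℤ → (ℕ → ℤ) → ℕ → ℤ
T c a zero    = a 0
T c a (suc n) = c * T c a n + T c (a ∘ suc) n

T-cong : ∀ c n {a b : ℕ → ℤ} → (∀ i → i ≤ n → a i ≡ b i) → T c a n ≡ T c b n
T-cong c zero    a≡b = a≡b 0 z≤n
T-cong c (suc n) a≡b = cong₂ (λ x y → c * x + y)
  (T-cong c n (λ i i≤n → a≡b i (ℕₚ.m≤n⇒m≤1+n i≤n)))
  (T-cong c n (λ i i≤n → a≡b (suc i) (s≤s i≤n)))

T-+ : ∀ c n (a b : ℕ → ℤ) → T c (λ i → a i + b i) n ≡ T c a n + T c b n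
T-+ c zero    a b = refl
T-+ c (suc n) a b = begin
  c * T c (λ i → a i + b i) n + T c (λ i → a (suc i) + b (suc i)) n
    ≡⟨ cong₂ (λ x y → c * x + y) (T-+ c n a b) (T-+ c n (a ∘ suc) (b ∘ suc)) ⟩
  c * (T c a n + T c b n) + (T c (a ∘ suc) n + T c (b ∘ suc) n)
    ≡⟨ regroup c (T c a n) (T c b n) (T c (a ∘ suc) n) (T c (b ∘ suc) n) ⟩
  T c a (suc n) + T c b (suc n) ∎
  where
  open ≡-Reasoning
  regroup : ∀ c x y x′ y′ → c * (x + y) + (x′ + y′) ≡ (c * x + x′) + (c * y + y′)
  regroup = solve-∀

T-*ˡ : ∀ c n u (a : ℕ → ℤ) → T c (λ i → u * a i) n ≡ u * T c a n
T-*ˡ c zero    u a = refl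
T-*ˡ c (suc n) u a = begin
  c * T c (λ i → u * a i) n + T c (λ i → u * a (suc i)) n
    ≡⟨ cong₂ (λ x y → c * x + y) (T-*ˡ c n u a) (T-*ˡ c n u (a ∘ suc)) ⟩
  c * (u * T c a n) + u * T c (a ∘ suc) n
    ≡⟨ regroup c u (T c a n) (T c (a ∘ suc) n) ⟩
  u * T c a (suc n) ∎
  where
  open ≡-Reasoning
  regroup : ∀ c u x y → c * (u * x) + u * y ≡ u * (c * x + y)
  regroup = solve-∀

T-zero : ∀ n (a : ℕ → ℤ) → T 0ℤ a n ≡ a n
T-zero zero    a = refl
T-zero (suc n) a = trans (ℤₚ.+-identityˡ _) (T-zero n (a ∘ suc))

T-∘-T : ∀ n c d (a : ℕ → ℤ) → T c (T d a) n ≡ T (c + d) a n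
T-∘-T zero    c d a = refl
T-∘-T (suc n) c d a = begin
  c * T c (T d a) n + T c (λ i → d * T d a i + T d (a ∘ suc) i) n
    ≡⟨ cong (_+_ (c * T c (T d a) n)) (T-+ c n _ _) ⟩
  c * T c (T d a) n + (T c (λ i → d * T d a i) n + T c (T d (a ∘ suc)) n)
    ≡⟨ cong (λ x → c * T c (T d a) n + (x + T c (T d (a ∘ suc)) n)) (T-*ˡ c n d (T d a)) ⟩
  c * T c (T d a) n + (d * T c (T d a) n + T c (T d (a ∘ suc)) n)
    ≡⟨ cong₂ (λ x y → c * x + (d * x + y)) (T-∘-T n c d a) (T-∘-T n c d (a ∘ suc)) ⟩
  c * T (c + d) a n + (d * T (c + d) a n + T (c + d) (a ∘ suc) n)
    ≡⟨ regroup c d (T (c + d) a n) (T (c + d) (a ∘ suc) n) ⟩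
  T (c + d) a (suc n) ∎
  where
  open ≡-Reasoning
  regroup : ∀ c d x y → c * x + (d * x + y) ≡ (c + d) * x + y
  regroup = solve-∀

T-pow : ∀ n c x → T c (x ^_) n ≡ (x + c) ^ n
T-pow zero    c x = refl
T-pow (suc n) c x = begin
  c * T c (x ^_) n + T c (λ i → x * x ^ i) n ≡⟨ cong (_+_ (c * T c (x ^_) n)) (T-*ˡ c n x (x ^_)) ⟩
  c * T c (x ^_) n + x * T c (x ^_) n       ≡⟨ ℤₚ.*-distribʳ-+ (T c (x ^_) n) c x ⟨
  (c + x) * T c (x ^_) n                    ≡⟨ cong₂ _*_ (ℤₚ.+-comm c x) (T-pow n c x) ⟩
  (x + c) * (x + c) ^ n                     ∎
  where open ≡-Reasoning

T-index-* : ∀ n c (a : ℕ → ℤ) → T c (λ i → + i * a i) (suc n) ≡ + suc n * T c (a ∘ suc) n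
T-index-* zero    c a = base c (a 0) (a 1)
  where
  base : ∀ c x y → c * (0ℤ * x) + 1ℤ * y ≡ 1ℤ * y
  base = solve-∀
T-index-* (suc n) c a = begin
  c * T c (λ i → + i * a i) (suc n) + T c (λ i → + suc i * a (suc i)) (suc n)
    ≡⟨ cong₂ (λ x y → c * x + y) (T-index-* n c a) (T-cong c (suc n) (λ i _ → split i)) ⟩
  c * (+ suc n * T c b n) + T c (λ i → + i * b i + b i) (suc n)
    ≡⟨ cong (_+_ (c * (+ suc n * T c b n))) (T-+ c (suc n) (λ i → + i * b i) b) ⟩
  c * (+ suc n * T c b n) + (T c (λ i → + i * b i) (suc n) + T c b (suc n))
    ≡⟨ cong (λ x → c * (+ suc n * T c b n) + (x + T c b (suc n))) (T-index-* n c b) ⟩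
  c * (+ suc n * T c b n) + (+ suc n * T c (b ∘ suc) n + T c b (suc n))
    ≡⟨ regroup c (+ suc n) (T c b n) (T c (b ∘ suc) n) ⟩
  + suc (suc n) * T c b (suc n) ∎
  where
  open ≡-Reasoning
  b : ℕ → ℤ
  b = a ∘ suc
  split : ∀ i → + suc i * b i ≡ + i * b i + b i
  split i = succ-* (+ i) (b i)
    where
    succ-* : ∀ k x → (1ℤ + k) * x ≡ k * x + x
    succ-* = solve-∀
  regroup : ∀ c k x y → c * (k * x) + (k * y + (c * x + y)) ≡ (1ℤ + k) * (c * x + y)
  regroup = solve-∀

T-explicit : ∀ n c (a : ℕ → ℤ) → T c a n ≡ ∑[ i < suc n ] (+ (n C i) * c ^ (n ∸ i) * a i)
T-explicit zero    c a = sym (trans (ℤₚ.+-identityˡ _) (ℤₚ.*-identityˡ (a 0)))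
T-explicit (suc n) c a = begin
  c * T c a n + T c a′ n
    ≡⟨ cong₂ (λ x y → c * x + y) (T-explicit n c a) (T-explicit n c a′) ⟩
  c * ∑ (suc n) (term n a) + ∑ (suc n) (term n a′)
    ≡⟨ cong (λ x → c * x + ∑ (suc n) (term n a′)) (∑-head n (term n a)) ⟩
  c * (term n a 0 + ∑ n (term n a ∘ suc)) + ∑ (suc n) (term n a′)
    ≡⟨ cong (λ x → c * (term n a 0 + x) + ∑ (suc n) (term n a′)) (∑-last-zero n (term n a ∘ suc) beyond) ⟨
  c * (term n a 0 + ∑ (suc n) (term n a ∘ suc)) + ∑ (suc n) (term n a′)
    ≡⟨ regroup c (term n a 0) (∑ (suc n) (term n a ∘ suc)) (∑ (suc n) (term n a′)) ⟩
  c * term n a 0 + (∑ (suc n) (term n a′) + c * ∑ (suc n) (term n a ∘ suc))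
    ≡⟨ cong (λ x → c * term n a 0 + (∑ (suc n) (term n a′) + x)) (∑-*ˡ (suc n) c (term n a ∘ suc)) ⟨
  c * term n a 0 + (∑ (suc n) (term n a′) + ∑[ i < suc n ] (c * term n a (suc i)))
    ≡⟨ cong₂ _+_ (head c (c ^ n) (a 0)) (sym (∑-+ (suc n) (term n a′) (λ i → c * term n a (suc i)))) ⟩
  term (suc n) a 0 + ∑[ i < suc n ] (term n a′ i + c * term n a (suc i))
    ≡⟨ cong (_+_ (term (suc n) a 0)) (∑-cong (suc n) (λ i _ → pascal-term n i c (a (suc i)))) ⟨
  term (suc n) a 0 + ∑ (suc n) (term (suc n) a ∘ suc)
    ≡⟨ ∑-head (suc n) (term (suc n) a) ⟨
  ∑ (suc (suc n)) (term (suc n) a) ∎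
  where
  open ≡-Reasoning
  a′ : ℕ → ℤ
  a′ = a ∘ suc
  term : ℕ → (ℕ → ℤ) → ℕ → ℤ
  term n a i = + (n C i) * c ^ (n ∸ i) * a i
  beyond : term n a (suc n) ≡ 0ℤ
  beyond rewrite k>n⇒nCk≡0 (ℕₚ.n<1+n n) = trans (cong (_* a (suc n)) (ℤₚ.*-zeroˡ (c ^ (n ∸ suc n)))) (ℤₚ.*-zeroˡ (a (suc n)))
  regroup : ∀ c x y z → c * (x + y) + z ≡ c * x + (z + c * y)
  regroup = solve-∀
  head : ∀ c e x → c * (1ℤ * e * x) ≡ 1ℤ * (c * e) * x
  head = solve-∀

binomial-sum-reversed : ∀ n (a : ℕ → ℤ) → ∑[ k < suc n ] (+ (n C k) * a (n ∸ k)) ≡ T 1ℤ a n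
binomial-sum-reversed n a = begin
  ∑[ k < suc n ] (+ (n C k) * a (n ∸ k))                 ≡⟨ ∑-reverse n _ ⟩
  ∑[ i < suc n ] (+ (n C (n ∸ i)) * a (n ∸ (n ∸ i)))     ≡⟨ ∑-cong (suc n) (λ i i≤n → term (ℕₚ.m<1+n⇒m≤n i≤n)) ⟩
  ∑[ i < suc n ] (+ (n C i) * 1ℤ ^ (n ∸ i) * a i)        ≡⟨ T-explicit n 1ℤ a ⟨
  T 1ℤ a n                                               ∎
  where
  open ≡-Reasoning
  term : ∀ {i} → i ≤ n → + (n C (n ∸ i)) * a (n ∸ (n ∸ i)) ≡ + (n C i) * 1ℤ ^ (n ∸ i) * a i
  term {i} i≤n = begin
    + (n C (n ∸ i)) * a (n ∸ (n ∸ i))     ≡⟨ cong₂ (λ k j → + k * a j) (nCk≡nC[n∸k] i≤n) (sym (ℕₚ.m∸[m∸n]≡n i≤n)) ⟨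
    + (n C i) * a i                       ≡⟨ cong (_* a i) (ℤₚ.*-identityʳ (+ (n C i))) ⟨
    + (n C i) * 1ℤ * a i                  ≡⟨ cong (λ x → + (n C i) * x * a i) (ℤₚ.^-zeroˡ (n ∸ i)) ⟨
    + (n C i) * 1ℤ ^ (n ∸ i) * a i        ∎

T-recurrence-unique : ∀ {a b : ℕ → ℤ} → a 0 ≡ b 0 →
  (∀ n → a (suc n) ≡ T 1ℤ a n) → (∀ n → b (suc n) ≡ T 1ℤ b n) → ∀ n → a n ≡ b n
T-recurrence-unique {a} {b} a₀≡b₀ a-rec b-rec n = below (suc n) (ℕₚ.n<1+n n)
  where
  below : ∀ m {i} → i < m → a i ≡ b i
  below (suc m) {zero}  _         = a₀≡b₀
  below (suc m) {suc i} (s≤s i<m) =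
    trans (a-rec i) (trans (T-cong 1ℤ i (λ j j≤i → below m (ℕₚ.<-≤-trans (s≤s j≤i) i<m))) (sym (b-rec i)))

-- Stirling numbers of the second kind

stirling₂ : ℕ → ℕ → ℕ
stirling₂ zero    zero    = 1
stirling₂ zero    (suc k) = 0
stirling₂ (suc n) zero    = 0
stirling₂ (suc n) (suc k) = suc k ℕ.* stirling₂ n (suc k) ℕ.+ stirling₂ n k

n<k⇒stirling₂≡0 : ∀ {n k} → n < k → stirling₂ n k ≡ 0
n<k⇒stirling₂≡0 {zero}  {suc k} _         = refl
n<k⇒stirling₂≡0 {suc n} {suc k} (s≤s n<k)
  rewrite n<k⇒stirling₂≡0 (ℕₚ.m<n⇒m<1+n n<k) | n<k⇒stirling₂≡0 n<k = trans (ℕₚ.+-identityʳ _) (ℕₚ.*-zeroʳ (suc k))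

stirling₂[n,n]≡1 : ∀ n → stirling₂ n n ≡ 1
stirling₂[n,n]≡1 zero    = refl
stirling₂[n,n]≡1 (suc n) rewrite n<k⇒stirling₂≡0 (ℕₚ.n<1+n n) | stirling₂[n,n]≡1 n | ℕₚ.*-zeroʳ n = refl

stirling₂[1+n,1]≡1 : ∀ n → stirling₂ (suc n) 1 ≡ 1
stirling₂[1+n,1]≡1 zero    = refl
stirling₂[1+n,1]≡1 (suc n) rewrite stirling₂[1+n,1]≡1 n = refl

∑-stirling₂-suc : ∀ m (f : ℕ → ℤ) →
  ∑[ j < suc (suc m) ] (+ stirling₂ (suc m) j * f j) ≡ ∑[ j < suc m ] (+ stirling₂ m j * (f (suc j) + + j * f j))
∑-stirling₂-suc m f = begin
  ∑[ j < suc (suc m) ] (+ stirling₂ (suc m) j * f j)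
    ≡⟨ ∑-drop-head (suc m) _ (ℤₚ.*-zeroˡ (f 0)) ⟩
  ∑[ j < suc m ] (+ stirling₂ (suc m) (suc j) * f (suc j))
    ≡⟨ ∑-cong (suc m) (λ j _ → recurrence j) ⟩
  ∑[ j < suc m ] (shifted j + weighted (suc j))
    ≡⟨ ∑-+ (suc m) shifted (weighted ∘ suc) ⟩
  ∑ (suc m) shifted + ∑ (suc m) (weighted ∘ suc)
    ≡⟨ cong (_+_ (∑ (suc m) shifted)) (∑-shift m weighted weighted-first weighted-last) ⟨
  ∑ (suc m) shifted + ∑ (suc m) weighted
    ≡⟨ ∑-+ (suc m) shifted weighted ⟨
  ∑[ j < suc m ] (shifted j + weighted j)
    ≡⟨ ∑-cong (suc m) (λ j _ → ℤₚ.*-distribˡ-+ (+ stirling₂ m j) (f (suc j)) (+ j * f j)) ⟨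
  ∑[ j < suc m ] (+ stirling₂ m j * (f (suc j) + + j * f j)) ∎
  where
  open ≡-Reasoning
  shifted weighted : ℕ → ℤ
  shifted  j = + stirling₂ m j * f (suc j)
  weighted j = + stirling₂ m j * (+ j * f j)
  weighted-first : weighted 0 ≡ 0ℤ
  weighted-first = trans (cong (_*_ (+ stirling₂ m 0)) (ℤₚ.*-zeroˡ (f 0))) (ℤₚ.*-zeroʳ (+ stirling₂ m 0))
  weighted-last : weighted (suc m) ≡ 0ℤ
  weighted-last rewrite n<k⇒stirling₂≡0 (ℕₚ.n<1+n m) = ℤₚ.*-zeroˡ (+ suc m * f (suc m))
  recurrence : ∀ j → + stirling₂ (suc m) (suc j) * f (suc j) ≡ shifted j + weighted (suc j)
  recurrence j = begin
    + (suc j ℕ.* s₁ ℕ.+ s₀) * f (suc j)      ≡⟨ cong (_* f (suc j)) (ℤₚ.pos-+ (suc j ℕ.* s₁) s₀) ⟩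
    (+ (suc j ℕ.* s₁) + + s₀) * f (suc j)    ≡⟨ cong (λ x → (x + + s₀) * f (suc j)) (ℤₚ.pos-* (suc j) s₁) ⟩
    (+ suc j * + s₁ + + s₀) * f (suc j)      ≡⟨ regroup (+ suc j) (+ s₁) (+ s₀) (f (suc j)) ⟩
    shifted j + weighted (suc j)             ∎
    where
    s₁ s₀ : ℕ
    s₁ = stirling₂ m (suc j)
    s₀ = stirling₂ m j
    regroup : ∀ k s s′ x → (k * s + s′) * x ≡ s′ * x + s * (k * x)
    regroup = solve-∀

stirling₂-explicit : ∀ n j → T -1ℤ (λ i → (+ i) ^ n) j ≡ + (j ! ℕ.* stirling₂ n j)
stirling₂-explicit zero    zero    = refl
stirling₂-explicit zero    (suc j) = begin
  -1ℤ * T -1ℤ (λ _ → 1ℤ) j + T -1ℤ (λ _ → 1ℤ) j ≡⟨ cancel (T -1ℤ (λ _ → 1ℤ) j) ⟩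
  0ℤ                                            ≡⟨ cong +_ (ℕₚ.*-zeroʳ (suc j !)) ⟨
  + (suc j ! ℕ.* 0)                             ∎
  where
  open ≡-Reasoning
  cancel : ∀ x → -1ℤ * x + x ≡ 0ℤ
  cancel = solve-∀
stirling₂-explicit (suc n) zero    = ℤₚ.*-zeroˡ ((+ 0) ^ n)
stirling₂-explicit (suc n) (suc j) = begin
  T -1ℤ (λ i → + i * a i) (suc j)
    ≡⟨ T-index-* j -1ℤ a ⟩
  + suc j * T -1ℤ (a ∘ suc) j
    ≡⟨ cong (_*_ (+ suc j)) (unshift (T -1ℤ a j) (T -1ℤ (a ∘ suc) j)) ⟩
  + suc j * (T -1ℤ a (suc j) + T -1ℤ a j)
    ≡⟨ cong (_*_ (+ suc j)) (cong₂ _+_ (stirling₂-explicit n (suc j)) (stirling₂-explicit n j)) ⟩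
  + suc j * (+ (suc j ! ℕ.* s₁) + + (j ! ℕ.* s₀))
    ≡⟨ cong (_*_ (+ suc j)) (ℤₚ.pos-+ (suc j ! ℕ.* s₁) (j ! ℕ.* s₀)) ⟨
  + suc j * + (suc j ! ℕ.* s₁ ℕ.+ j ! ℕ.* s₀)
    ≡⟨ ℤₚ.pos-* (suc j) (suc j ! ℕ.* s₁ ℕ.+ j ! ℕ.* s₀) ⟨
  + (suc j ℕ.* (suc j ! ℕ.* s₁ ℕ.+ j ! ℕ.* s₀))
    ≡⟨ cong +_ (factor (suc j) (j !) s₁ s₀) ⟩
  + (suc j ! ℕ.* stirling₂ (suc n) (suc j)) ∎
  where
  open ≡-Reasoning
  a : ℕ → ℤ
  a i = (+ i) ^ n
  s₁ s₀ : ℕ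
  s₁ = stirling₂ n (suc j)
  s₀ = stirling₂ n j
  unshift : ∀ x y → y ≡ (-1ℤ * x + y) + x
  unshift = solve-∀
  factor : ∀ k f s₁ s₀ → k ℕ.* (k ℕ.* f ℕ.* s₁ ℕ.+ f ℕ.* s₀) ≡ k ℕ.* f ℕ.* (k ℕ.* s₁ ℕ.+ s₀)
  factor = ℕ-Solver.solve-∀

-- The sequences B and V

module _ (a : ℕ → ℕ) (lookup : ℕ → ℕ → ℕ)
         (head : ∀ n → lookup n 0 ≡ a n) (shift : ∀ m k → lookup (suc m) (suc k) ≡ lookup m k) where

  lookup-∸ : ∀ {n k} → k ≤ n → lookup n k ≡ a (n ∸ k)
  lookup-∸ {n}     {zero}  _         = head n
  lookup-∸ {suc n} {suc k} (s≤s k≤n) = trans (shift n k) (lookup-∸ k≤n)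

  table-∑≡T : ∀ n → ∑[ k < suc n ] (+ ((n C k) ℕ.* lookup n k)) ≡ T 1ℤ (+_ ∘ a) n
  table-∑≡T n = trans (∑-cong (suc n) (λ k k≤n → term (ℕₚ.m<1+n⇒m≤n k≤n))) (binomial-sum-reversed n (+_ ∘ a))
    where
    term : ∀ {k} → k ≤ n → + ((n C k) ℕ.* lookup n k) ≡ + (n C k) * + a (n ∸ k)
    term {k} k≤n = trans (cong (λ b → + ((n C k) ℕ.* b)) (lookup-∸ k≤n)) (ℤₚ.pos-* (n C k) (a (n ∸ k)))

  table-sum≡T : ∀ n → + sum (map (λ k → (n C k) ℕ.* lookup n k) (upTo (suc n))) ≡ T 1ℤ (+_ ∘ a) n
  table-sum≡T n = trans (sum-upTo (suc n) _) (table-∑≡T n)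

module _ (a : ℕ → ℕ) (tail : ℕ → ℕ → ℕ)
         (head : ∀ m → tail (suc m) 0 ≡ a m) (shift : ∀ m k → tail (suc m) (suc k) ≡ tail m k) where

  private
    lookup : ℕ → ℕ → ℕ
    lookup n zero    = a n
    lookup n (suc k) = tail n k

    lookup-shift : ∀ m k → lookup (suc m) (suc k) ≡ lookup m k
    lookup-shift m zero    = head m
    lookup-shift m (suc k) = shift m k

  tail-table-sum≡T : ∀ n → + sum (map (λ k → (n C suc k) ℕ.* tail n k) (upTo n)) + + a n ≡ T 1ℤ (+_ ∘ a) n
  tail-table-sum≡T n = begin
    + sum (map f (upTo n)) + + a n                 ≡⟨ cong (_+ + a n) (sum-upTo n f) ⟩
    ∑[ k < n ] (+ f k) + + a n                     ≡⟨ ℤₚ.+-comm (∑[ k < n ] (+ f k)) (+ a n) ⟩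
    + a n + ∑[ k < n ] (+ f k)                     ≡⟨ cong (λ x → + x + ∑[ k < n ] (+ f k)) (ℕₚ.*-identityˡ (a n)) ⟨
    + (1 ℕ.* a n) + ∑[ k < n ] (+ f k)             ≡⟨ ∑-head n _ ⟨
    ∑[ k < suc n ] (+ ((n C k) ℕ.* lookup n k))    ≡⟨ table-∑≡T a lookup (λ _ → refl) lookup-shift n ⟩
    T 1ℤ (+_ ∘ a) n                                ∎
    where
    open ≡-Reasoning
    f : ℕ → ℕ
    f k = (n C suc k) ℕ.* tail n k

Bℤ Vℤ : ℕ → ℤ
Bℤ n = + B n
Vℤ n = + V n

-- `Defs` keeps its table lookup private; unification recovers it from the unfolded recurrences.
-- The recurrence for V reads the table only at successors, hence the variant with a tail table.
B-suc : ∀ n → Bℤ (suc n) ≡ T 1ℤ Bℤ n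
B-suc = table-sum≡T B _ (λ _ → refl) (λ _ _ → refl)

V-suc : ∀ n → Vℤ (suc n) + Vℤ n ≡ T 1ℤ Vℤ n
V-suc = tail-table-sum≡T V _ (λ _ → refl) (λ _ _ → refl)

T[1]V≡B : ∀ n → T 1ℤ Vℤ n ≡ Bℤ n
T[1]V≡B = T-recurrence-unique refl T-V-suc B-suc
  where
  T-V-suc : ∀ n → T 1ℤ Vℤ (suc n) ≡ T 1ℤ (T 1ℤ Vℤ) n
  T-V-suc n = begin
    1ℤ * T 1ℤ Vℤ n + T 1ℤ (Vℤ ∘ suc) n                 ≡⟨ cong (_+ T 1ℤ (Vℤ ∘ suc) n) (ℤₚ.*-identityˡ (T 1ℤ Vℤ n)) ⟩
    T 1ℤ Vℤ n + T 1ℤ (Vℤ ∘ suc) n                      ≡⟨ T-+ 1ℤ n Vℤ (Vℤ ∘ suc) ⟨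
    T 1ℤ (λ i → Vℤ i + Vℤ (suc i)) n                   ≡⟨ T-cong 1ℤ n (λ i _ → trans (ℤₚ.+-comm (Vℤ i) (Vℤ (suc i))) (V-suc i)) ⟩
    T 1ℤ (T 1ℤ Vℤ) n                                   ∎
    where open ≡-Reasoning

V-suc≡B-V : ∀ n → Vℤ (suc n) ≡ Bℤ n - Vℤ n
V-suc≡B-V n = trans (sym (cancel (Vℤ (suc n)) (Vℤ n))) (cong (_- Vℤ n) (trans (V-suc n) (T[1]V≡B n)))
  where
  cancel : ∀ x y → x + y - y ≡ x
  cancel = solve-∀

V≡T[-1]B : ∀ n → Vℤ n ≡ T -1ℤ Bℤ n
V≡T[-1]B n = begin
  Vℤ n                  ≡⟨ T-zero n Vℤ ⟨
  T 0ℤ Vℤ n             ≡⟨ T-∘-T n -1ℤ 1ℤ Vℤ ⟨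
  T -1ℤ (T 1ℤ Vℤ) n     ≡⟨ T-cong -1ℤ n (λ i _ → T[1]V≡B i) ⟩
  T -1ℤ Bℤ n            ∎
  where open ≡-Reasoning

T-B-suc : ∀ c n → T c Bℤ (suc n) ≡ T (1ℤ + c) Bℤ n + c * T c Bℤ n
T-B-suc c n = begin
  c * T c Bℤ n + T c (Bℤ ∘ suc) n       ≡⟨ cong (_+_ (c * T c Bℤ n)) (T-cong c n (λ i _ → B-suc i)) ⟩
  c * T c Bℤ n + T c (T 1ℤ Bℤ) n        ≡⟨ cong (_+_ (c * T c Bℤ n)) (T-∘-T n c 1ℤ Bℤ) ⟩
  c * T c Bℤ n + T (c + 1ℤ) Bℤ n        ≡⟨ cong (λ d → c * T c Bℤ n + T d Bℤ n) (ℤₚ.+-comm c 1ℤ) ⟩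
  c * T c Bℤ n + T (1ℤ + c) Bℤ n        ≡⟨ ℤₚ.+-comm (c * T c Bℤ n) (T (1ℤ + c) Bℤ n) ⟩
  T (1ℤ + c) Bℤ n + c * T c Bℤ n        ∎
  where open ≡-Reasoning

stirling₂-expansion : ∀ m n → Bℤ (m ℕ.+ n) ≡ ∑[ j < suc m ] (+ stirling₂ m j * T (+ j) Bℤ n)
stirling₂-expansion zero    n = sym (trans (ℤₚ.+-identityˡ _) (trans (ℤₚ.*-identityˡ _) (T-zero n Bℤ)))
stirling₂-expansion (suc m) n = begin
  Bℤ (suc m ℕ.+ n)
    ≡⟨ cong Bℤ (ℕₚ.+-suc m n) ⟨
  Bℤ (m ℕ.+ suc n)
    ≡⟨ stirling₂-expansion m (suc n) ⟩
  ∑[ j < suc m ] (+ stirling₂ m j * T (+ j) Bℤ (suc n))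
    ≡⟨ ∑-cong (suc m) (λ j _ → cong (_*_ (+ stirling₂ m j)) (T-B-suc (+ j) n)) ⟩
  ∑[ j < suc m ] (+ stirling₂ m j * (T (+ suc j) Bℤ n + + j * T (+ j) Bℤ n)) ≡⟨ ∑-stirling₂-suc m (λ j → T (+ j) Bℤ n) ⟨
  ∑[ j < suc (suc m) ] (+ stirling₂ (suc m) j * T (+ j) Bℤ n) ∎
  where open ≡-Reasoning

-- Congruences

module Modulo (m : ℕ) where

  infix 4 _≈_
  record _≈_ (x y : ℤ) : Set where
    constructor mod
    field m∣x-y : + m Signed.∣ x - y

  private
    by : ∀ {x y} → x ≡ y → + m Signed.∣ x → + m Signed.∣ y
    by = subst (+ m Signed.∣_)

  ≈⇒∣ : ∀ {x y} → x ≈ y → + m ∣ x - y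
  ≈⇒∣ (mod m∣x-y) = Signed.∣⇒∣ᵤ m∣x-y

  ≈-reflexive : ∀ {x y} → x ≡ y → x ≈ y
  ≈-reflexive {x} refl = mod (Signed.divides 0ℤ (trans (ℤₚ.+-inverseʳ x) (sym (ℤₚ.*-zeroˡ (+ m)))))

  ≈-refl : ∀ {x} → x ≈ x
  ≈-refl = ≈-reflexive refl

  ≈-sym : ∀ {x y} → x ≈ y → y ≈ x
  ≈-sym {x} {y} (mod x≈y) = mod (by (flip x y) (Signed.∣m⇒∣-m x≈y))
    where
    flip : ∀ x y → - (x - y) ≡ y - x
    flip = solve-∀

  ≈-trans : ∀ {x y z} → x ≈ y → y ≈ z → x ≈ z
  ≈-trans {x} {y} {z} (mod x≈y) (mod y≈z) = mod (by (chain x y z) (Signed.∣m∣n⇒∣m+n x≈y y≈z))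
    where
    chain : ∀ x y z → (x - y) + (y - z) ≡ x - z
    chain = solve-∀

  ≈-setoid : Setoid _ _
  ≈-setoid = record
    { Carrier       = ℤ
    ; _≈_           = _≈_
    ; isEquivalence = record { refl = ≈-refl ; sym = ≈-sym ; trans = ≈-trans }
    }

  module ≈-Reasoning = SetoidReasoning ≈-setoid

  +-cong : ∀ {x y u v} → x ≈ y → u ≈ v → x + u ≈ y + v
  +-cong {x} {y} {u} {v} (mod x≈y) (mod u≈v) = mod (by (regroup x y u v) (Signed.∣m∣n⇒∣m+n x≈y u≈v))
    where
    regroup : ∀ x y u v → (x - y) + (u - v) ≡ (x + u) - (y + v)
    regroup = solve-∀

  *-cong : ∀ {x y u v} → x ≈ y → u ≈ v → x * u ≈ y * v
  *-cong {x} {y} {u} {v} (mod x≈y) (mod u≈v) =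
    mod (by (regroup x y u v) (Signed.∣m∣n⇒∣m+n (Signed.∣n⇒∣m*n u x≈y) (Signed.∣n⇒∣m*n y u≈v)))
    where
    regroup : ∀ x y u v → u * (x - y) + y * (u - v) ≡ x * u - y * v
    regroup = solve-∀

  -‿cong : ∀ {x y} → x ≈ y → - x ≈ - y
  -‿cong {x} {y} (mod x≈y) = mod (by (regroup x y) (Signed.∣m⇒∣-m x≈y))
    where
    regroup : ∀ x y → - (x - y) ≡ - x - - y
    regroup = solve-∀

  ^-cong : ∀ n {x y} → x ≈ y → x ^ n ≈ y ^ n
  ^-cong zero    x≈y = ≈-refl
  ^-cong (suc n) x≈y = *-cong x≈y (^-cong n x≈y)

  x≈0⇒x*y≈0 : ∀ {x} y → x ≈ 0ℤ → x * y ≈ 0ℤ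
  x≈0⇒x*y≈0 y x≈0 = ≈-trans (*-cong x≈0 ≈-refl) (≈-reflexive (ℤₚ.*-zeroˡ y))

  ∣⇒≈0 : ∀ {k} → m ℕ.∣ k → + k ≈ 0ℤ
  ∣⇒≈0 {k} m∣k = mod (Signed.∣ᵤ⇒∣ (subst (m ℕ.∣_) (sym (ℕₚ.+-identityʳ k)) m∣k))

  ≈0⇒∣ : ∀ {k} → + k ≈ 0ℤ → m ℕ.∣ k
  ≈0⇒∣ {k} (mod k≈0) = subst (m ℕ.∣_) (ℕₚ.+-identityʳ k) (Signed.∣⇒∣ᵤ k≈0)

  ∑-≈0 : ∀ n {f : ℕ → ℤ} → (∀ i → i < n → f i ≈ 0ℤ) → ∑ n f ≈ 0ℤ
  ∑-≈0 zero    f≈0 = ≈-refl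
  ∑-≈0 (suc n) f≈0 = +-cong (∑-≈0 n (λ i i<n → f≈0 i (ℕₚ.m<n⇒m<1+n i<n))) (f≈0 n (ℕₚ.n<1+n n))

  ∑-ends : ∀ k (f : ℕ → ℤ) → (∀ i → i < k → f (suc i) ≈ 0ℤ) → ∑ (suc (suc k)) f ≈ f 0 + f (suc k)
  ∑-ends k f inner≈0 = begin
    ∑ (suc k) f + f (suc k)              ≡⟨ cong (_+ f (suc k)) (∑-head k f) ⟩
    f 0 + ∑ k (f ∘ suc) + f (suc k)      ≈⟨ +-cong (+-cong (≈-refl {f 0}) (∑-≈0 k inner≈0)) ≈-refl ⟩
    f 0 + 0ℤ + f (suc k)                 ≡⟨ cong (_+ f (suc k)) (ℤₚ.+-identityʳ (f 0)) ⟩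
    f 0 + f (suc k)                      ∎
    where open ≈-Reasoning

  T-cong≈ : ∀ n {c d} {a b : ℕ → ℤ} → c ≈ d → (∀ i → a i ≈ b i) → T c a n ≈ T d b n
  T-cong≈ zero    c≈d a≈b = a≈b 0
  T-cong≈ (suc n) c≈d a≈b = +-cong (*-cong c≈d (T-cong≈ n c≈d a≈b)) (T-cong≈ n c≈d (a≈b ∘ suc))

  T-modulus : ∀ n (a : ℕ → ℤ) → T (+ m) a n ≈ a n
  T-modulus n a = ≈-trans (T-cong≈ n m≈0 (λ i → ≈-refl)) (≈-reflexive (T-zero n a))
    where
    m≈0 : + m ≈ 0ℤ
    m≈0 = ∣⇒≈0 (ℕ.∣-refl)

-- Modulo a prime

module _ (q : ℕ) (p-prime : Prime (suc (suc q))) where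

  private
    p : ℕ
    p = suc (suc q)

  open Modulo p

  p∣m*n⇒p∤m⇒p∣n : ∀ {m n} → p ℕ.∣ m ℕ.* n → ¬ p ℕ.∣ m → p ℕ.∣ n
  p∣m*n⇒p∤m⇒p∣n {m} {n} p∣m*n p∤m with euclidsLemma m n p-prime p∣m*n
  ... | inj₁ p∣m = ⊥-elim (p∤m p∣m)
  ... | inj₂ p∣n = p∣n

  p∤j! : ∀ {j} → j < p → ¬ p ℕ.∣ j !
  p∤j! {zero}  _     = >⇒∤ (s≤s (s≤s z≤n))
  p∤j! {suc j} 1+j<p p∣[1+j]! = p∤j! (ℕₚ.<-trans (ℕₚ.n<1+n j) 1+j<p) (p∣m*n⇒p∤m⇒p∣n p∣[1+j]! (>⇒∤ 1+j<p))

  p∣pC[k+1] : ∀ {k} → suc k < p → p ℕ.∣ p C suc k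
  p∣pC[k+1] {k} 1+k<p = p∣m*n⇒p∤m⇒p∣n (divides (suc q C k) absorption) (>⇒∤ 1+k<p)
    where
    absorption : suc k ℕ.* (p C suc k) ≡ (suc q C k) ℕ.* p
    absorption = trans ([k+1]*[n+1]C[k+1]≡[n+1]*nCk (suc q) k) (ℕₚ.*-comm p (suc q C k))

  T-freshmans-dream : ∀ c (a : ℕ → ℤ) → T c a p ≈ c ^ p * a 0 + a p
  T-freshmans-dream c a = begin
    T c a p                            ≡⟨ T-explicit p c a ⟩
    ∑ (suc p) term                     ≈⟨ ∑-ends (suc q) term inner≈0 ⟩
    term 0 + term p                    ≡⟨ cong₂ (λ k e → term 0 + + k * c ^ e * a p) (nCn≡1 p) (ℕₚ.n∸n≡0 p) ⟩
    1ℤ * c ^ p * a 0 + 1ℤ * 1ℤ * a p   ≡⟨ unit (c ^ p) (a 0) (a p) ⟩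
    c ^ p * a 0 + a p                  ∎
    where
    open ≈-Reasoning
    term : ℕ → ℤ
    term i = + (p C i) * c ^ (p ∸ i) * a i
    inner≈0 : ∀ i → i < suc q → term (suc i) ≈ 0ℤ
    inner≈0 i i<1+q = x≈0⇒x*y≈0 (a (suc i)) (x≈0⇒x*y≈0 (c ^ (p ∸ suc i)) (∣⇒≈0 (p∣pC[k+1] (s≤s i<1+q))))
    unit : ∀ e x y → 1ℤ * e * x + 1ℤ * 1ℤ * y ≡ e * x + y
    unit = solve-∀

  fermat : ∀ x → (+ x) ^ p ≈ + x
  fermat zero    = ≈-refl
  fermat (suc x) = begin
    (+ suc x) ^ p                  ≡⟨ cong (_^ p) (ℤₚ.+-comm 1ℤ (+ x)) ⟩
    (+ x + 1ℤ) ^ p                 ≡⟨ T-pow p 1ℤ (+ x) ⟨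
    T 1ℤ ((+ x) ^_) p              ≈⟨ T-freshmans-dream 1ℤ ((+ x) ^_) ⟩
    1ℤ ^ p * 1ℤ + (+ x) ^ p        ≈⟨ +-cong (≈-reflexive (trans (ℤₚ.*-identityʳ (1ℤ ^ p)) (ℤₚ.^-zeroˡ p))) (fermat x) ⟩
    1ℤ + + x                       ≡⟨⟩
    + suc x                        ∎
    where open ≈-Reasoning

  [-1]^p≈-1 : -1ℤ ^ p ≈ -1ℤ
  [-1]^p≈-1 = ≈-trans (^-cong p -1≈p-1) (≈-trans (fermat (suc q)) (≈-sym -1≈p-1))
    where
    -1≈p-1 : -1ℤ ≈ + suc q
    -1≈p-1 = mod (Signed.divides -1ℤ (difference (+ q)))
      where
      difference : ∀ x → -1ℤ - (1ℤ + x) ≡ -1ℤ * (1ℤ + (1ℤ + x))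
      difference = solve-∀

  p∣stirling₂[p,j] : ∀ {j} → 1 < j → j < p → p ℕ.∣ stirling₂ p j
  p∣stirling₂[p,j] {j} 1<j j<p = p∣m*n⇒p∤m⇒p∣n (≈0⇒∣ j!S≈0) (p∤j! j<p)
    where
    j!S≈0 : + (j ! ℕ.* stirling₂ p j) ≈ 0ℤ
    j!S≈0 = begin
      + (j ! ℕ.* stirling₂ p j)      ≡⟨ stirling₂-explicit p j ⟨
      T -1ℤ (λ i → (+ i) ^ p) j      ≈⟨ T-cong≈ j ≈-refl (λ i → ≈-trans (fermat i) (≈-reflexive (sym (ℤₚ.^-identityʳ (+ i))))) ⟩
      T -1ℤ (λ i → (+ i) ^ 1) j      ≡⟨ stirling₂-explicit 1 j ⟩
      + (j ! ℕ.* stirling₂ 1 j)      ≡⟨ cong (λ s → + (j ! ℕ.* s)) (n<k⇒stirling₂≡0 1<j) ⟩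
      + (j ! ℕ.* 0)                  ≡⟨ cong +_ (ℕₚ.*-zeroʳ (j !)) ⟩
      0ℤ                             ∎
      where open ≈-Reasoning

  touchard : ∀ n → Bℤ (p ℕ.+ n) ≈ Bℤ (suc n) + Bℤ n
  touchard n = begin
    Bℤ (p ℕ.+ n)                   ≡⟨ stirling₂-expansion p n ⟩
    ∑ (suc p) term                 ≡⟨ ∑-head p term ⟩
    term 0 + ∑ p (term ∘ suc)      ≡⟨ cong (_+ ∑ p (term ∘ suc)) (ℤₚ.*-zeroˡ (T 0ℤ Bℤ n)) ⟩
    0ℤ + ∑ p (term ∘ suc)          ≡⟨ ℤₚ.+-identityˡ _ ⟩
    ∑ p (term ∘ suc)               ≈⟨ ∑-ends q (term ∘ suc) inner≈0 ⟩
    term 1 + term p                ≈⟨ +-cong (≈-reflexive first) last ⟩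
    Bℤ (suc n) + Bℤ n              ∎
    where
    open ≈-Reasoning
    term : ℕ → ℤ
    term j = + stirling₂ p j * T (+ j) Bℤ n
    inner≈0 : ∀ i → i < q → term (suc (suc i)) ≈ 0ℤ
    inner≈0 i i<q = x≈0⇒x*y≈0 _ (∣⇒≈0 (p∣stirling₂[p,j] (s≤s (s≤s z≤n)) (s≤s (s≤s i<q))))
    first : term 1 ≡ Bℤ (suc n)
    first = trans (cong (λ s → + s * T 1ℤ Bℤ n) (stirling₂[1+n,1]≡1 (suc q)))
                  (trans (ℤₚ.*-identityˡ _) (sym (B-suc n)))
    last : term p ≈ Bℤ n
    last = ≈-trans (≈-reflexive (trans (cong (λ s → + s * T (+ p) Bℤ n) (stirling₂[n,n]≡1 p)) (ℤₚ.*-identityˡ _)))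
                   (T-modulus n Bℤ)

  V[p]≈1 : Vℤ p ≈ 1ℤ
  V[p]≈1 = begin
    Vℤ p
      ≡⟨ V≡T[-1]B p ⟩
    T -1ℤ Bℤ p
      ≈⟨ T-freshmans-dream -1ℤ Bℤ ⟩
    -1ℤ ^ p * 1ℤ + Bℤ p
      ≈⟨ +-cong (*-cong [-1]^p≈-1 ≈-refl) (≈-trans (≈-reflexive (cong Bℤ (sym (ℕₚ.+-identityʳ p)))) (touchard 0)) ⟩
    -1ℤ * 1ℤ + (Bℤ 1 + Bℤ 0)
      ≡⟨⟩
    1ℤ ∎
    where open ≈-Reasoning

  V[p+m]≈B[m] : ∀ m → Vℤ (p ℕ.+ m) ≈ Bℤ m
  V[p+m]≈B[m] zero    = ≈-trans (≈-reflexive (cong Vℤ (ℕₚ.+-identityʳ p))) V[p]≈1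
  V[p+m]≈B[m] (suc m) = begin
    Vℤ (p ℕ.+ suc m)               ≡⟨ cong Vℤ (ℕₚ.+-suc p m) ⟩
    Vℤ (suc (p ℕ.+ m))             ≡⟨ V-suc≡B-V (p ℕ.+ m) ⟩
    Bℤ (p ℕ.+ m) - Vℤ (p ℕ.+ m)    ≈⟨ +-cong (touchard m) (-‿cong (V[p+m]≈B[m] m)) ⟩
    Bℤ (suc m) + Bℤ m - Bℤ m       ≡⟨ cancel (Bℤ (suc m)) (Bℤ m) ⟩
    Bℤ (suc m)                     ∎
    where
    open ≈-Reasoning
    cancel : ∀ x y → x + y - y ≡ x
    cancel = solve-∀

corollary3 : (p n : ℕ) → Prime p → n ≥ p → (+ p) ∣ (+ B (n ∸ p) - + V n)
corollary3 zero            n p-prime _   = ⊥-elim (¬prime[0] p-prime)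
corollary3 (suc zero)      n p-prime _   = ⊥-elim (¬prime[1] p-prime)
corollary3 p@(suc (suc q)) n p-prime n≥p = ≈⇒∣ (≈-sym V[n]≈B[n∸p])
  where
  open Modulo p
  V[n]≈B[n∸p] : Vℤ n ≈ Bℤ (n ∸ p)
  V[n]≈B[n∸p] = subst (λ k → Vℤ k ≈ Bℤ (n ∸ p)) (ℕₚ.m+[n∸m]≡n n≥p) (V[p+m]≈B[m] q p-prime (n ∸ p))
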